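{- Let $l$ be a positive integer, let $n$ be a positive integer that is not a Zumkeller number, and let $p$ be a prime with $\gcd(n,p)=1$. If $np^l$ is a Zumkeller number, then $p\le\sigma(n)$. If $np^l$ is a Zumkeller number and $\sigma(n)$ is odd, then $l$ is odd.
   Context: $\sigma(n)$ denotes the sum of all positive divisors of $n$. A positive integer $n$ is a Zumkeller number if the set of all positive divisors of $n$ can be partitioned into two disjoint parts whose sums are equal. -}

module Defs where

open import Data.Nat using (ℕ; zero; suc; _+_; _≤_)
open import Data.Nat.Divisibility using (_∣_; _∣?_)
open import Data.List using (List; []; _∷_; filter; length; map; upTo)
open import Data.Nat.ListAction using (sum)
open import Data.Bool using (Bool; true; false)
open import Data.Product using (Σ; _×_; ∃)
open import Relation.Binary.PropositionalEquality using (_≡_)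

divisors : ℕ → List ℕ
divisors n = filter (_∣? n) (map suc (upTo n))

σ : ℕ → ℕ
σ n = sum (divisors n)

sumWith : Bool → List ℕ → List Bool → ℕ
sumWith b [] _ = 0
sumWith b (x ∷ xs) [] = 0
sumWith true (x ∷ xs) (true ∷ bs) = x + sumWith true xs bs
sumWith true (x ∷ xs) (false ∷ bs) = sumWith true xs bs
sumWith false (x ∷ xs) (true ∷ bs) = sumWith false xs bs
sumWith false (x ∷ xs) (false ∷ bs) = x + sumWith false xs bs

-- n is Zumkeller: the set of positive divisors of n can be partitioned into two
-- disjoint parts (labelled true / false) with equal sums.
IsZumkeller : ℕ → Set
IsZumkeller n =
  Σ (List Bool) (λ bs → (length bs ≡ length (divisors n)) ×
                        (sumWith true (divisors n) bs ≡ sumWith false (divisors n) bs))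

IsOdd : ℕ → Set
IsOdd n = ∃ (λ k → n ≡ suc (k + k))

module Submission where

-- Let N = n·pˡ with p prime, p ∤ n.  The proof rests on splitting the divisor
-- list of N by divisibility by p:
--   * the divisors of N not divisible by p are exactly the divisors of n, and
--   * the divisors of p·K divisible by p are exactly p times the divisors of K.
-- (Both are list equalities, proved by comparing members of strictly sorted lists.)
--
-- Bound p ≤ σ(n): restrict a Zumkeller labelling of the divisors of N to the
-- divisors of n.  Each half-sum of N is its restricted half-sum plus a multiple
-- of p.  If σ(n) < p, both restricted half-sums are below p and congruent
-- mod p, hence equal, making n Zumkeller — a contradiction.
--
-- Parity of l: from the second splitting, σ(n·p^(l+1)) = σ(n) + p·σ(n·pˡ).
-- Two steps of this recursion show that σ(n) odd makes σ(n·p^(2k)) odd for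
-- every k, while the σ of a Zumkeller number is the sum of two equal halves,
-- hence even.  So l cannot be even.

open import Defs
open import Data.Nat using (ℕ; _*_; _^_; _≤_; _<_)
open import Data.Nat.GCD using (gcd)
open import Data.Nat.Primality using (Prime)
open import Data.Product using (_×_)
open import Relation.Nullary using (¬_)
open import Relation.Binary.PropositionalEquality using (_≡_)

open import Data.Nat using (zero; suc; _+_; z≤n; s≤s; nonTrivial⇒n>1; >-nonZero)
open import Data.Nat.Properties
open import Data.Nat.Divisibility
open import Data.Nat.DivMod using (_%_; [m+kn]%n≡m%n; m<n⇒m%n≡m)
open import Data.Nat.GCD using (gcd-greatest)
open import Data.Nat.Coprimality using (Coprime; coprime-divisor)
open import Data.Nat.Primality using (prime⇒irreducible; prime⇒nonTrivial)
open import Data.Nat.ListAction using (sum)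
open import Data.List using (List; []; _∷_; filter; length; map; upTo)
open import Data.List.Membership.Propositional using (_∈_)
open import Data.List.Membership.Propositional.Properties
  using (∈-map⁺; ∈-map⁻; ∈-filter⁺; ∈-filter⁻; ∈-upTo⁺)
open import Data.List.Relation.Unary.Any using (here; there)
import Data.List.Relation.Unary.All as All
open import Data.List.Relation.Unary.AllPairs as AllPairs using (AllPairs; _∷_)
import Data.List.Relation.Unary.AllPairs.Properties as AllPairsₚ
open import Data.Bool using (Bool; true; false)
open import Data.Product using (∃; _,_; proj₁; proj₂)
open import Data.Sum using (_⊎_; inj₁; inj₂)
open import Data.Empty using (⊥-elim)
open import Relation.Nullary using (Dec; yes; no; ¬?)
open import Relation.Unary using (Pred; Decidable)
open import Relation.Binary.PropositionalEquality
  using (_≢_; refl; sym; trans; cong; cong₂; subst; module ≡-Reasoning)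
open import Data.Nat.Solver using (module +-*-Solver)
open +-*-Solver using (solve; _:+_; _:*_; _:=_; con)

sorted-members-≡ : ∀ {xs ys : List ℕ} → AllPairs _<_ xs → AllPairs _<_ ys →
  (∀ {x} → x ∈ xs → x ∈ ys) → (∀ {y} → y ∈ ys → y ∈ xs) → xs ≡ ys
sorted-members-≡ {[]} {[]} _ _ _ _ = refl
sorted-members-≡ {[]} {y ∷ ys} _ _ _ ys⊆xs with ys⊆xs (here refl)
... | ()
sorted-members-≡ {x ∷ xs} {[]} _ _ xs⊆ys _ with xs⊆ys (here refl)
... | ()
sorted-members-≡ {x ∷ xs} {y ∷ ys} (x<xs ∷ xs↗) (y<ys ∷ ys↗) xs⊆ys ys⊆xs =
  cong₂ _∷_ x≡y (sorted-members-≡ xs↗ ys↗ tail⊆ tail⊇)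
  where
  -- the heads agree: each is a member of the other list and is its minimum
  x≡y : x ≡ y
  x≡y with xs⊆ys (here refl) | ys⊆xs (here refl)
  ... | here x≡y   | _          = x≡y
  ... | _          | here y≡x   = sym y≡x
  ... | there x∈ys | there y∈xs = ⊥-elim (<-asym (All.lookup y<ys x∈ys) (All.lookup x<xs y∈xs))
  tail⊆ : ∀ {z} → z ∈ xs → z ∈ ys
  tail⊆ z∈xs with xs⊆ys (there z∈xs)
  ... | here refl  = ⊥-elim (<-irrefl x≡y (All.lookup x<xs z∈xs))
  ... | there z∈ys = z∈ys
  tail⊇ : ∀ {z} → z ∈ ys → z ∈ xs
  tail⊇ z∈ys with ys⊆xs (there z∈ys)
  ... | here refl  = ⊥-elim (<-irrefl (sym x≡y) (All.lookup y<ys z∈ys))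
  ... | there z∈xs = z∈xs

divisors-sorted : ∀ m → AllPairs _<_ (divisors m)
divisors-sorted m = AllPairsₚ.filter⁺ (_∣? m)
  (AllPairsₚ.map⁺ (AllPairsₚ.applyUpTo⁺₁ (λ i → i) m (λ i<j _ → s≤s i<j)))

∈-divisors⁻ : ∀ m {d} → d ∈ divisors m → 0 < d × d ∣ m
∈-divisors⁻ m d∈ with ∈-filter⁻ (_∣? m) {xs = map suc (upTo m)} d∈
... | d∈range , d∣m with ∈-map⁻ suc d∈range
...   | _ , _ , refl = s≤s z≤n , d∣m

∈-divisors⁺ : ∀ m {d} → 0 < m → 0 < d → d ∣ m → d ∈ divisors m
∈-divisors⁺ (suc m) {suc d} _ _ d∣m =
  ∈-filter⁺ (_∣? suc m) (∈-map⁺ suc (∈-upTo⁺ (∣⇒≤ d∣m))) d∣m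

prime>1 : ∀ {p} → Prime p → 1 < p
prime>1 {p} p-prime = nonTrivial⇒n>1 p {{prime⇒nonTrivial p-prime}}

prime>0 : ∀ {p} → Prime p → 0 < p
prime>0 p-prime = <-trans (s≤s z≤n) (prime>1 p-prime)

*-positive : ∀ {m n} → 0 < m → 0 < n → 0 < m * n
*-positive {suc m} {suc n} _ _ = s≤s z≤n

*-positive⁻ : ∀ m {n} → 0 < m * n → 0 < m
*-positive⁻ (suc m) _ = s≤s z≤n

*^-positive : ∀ {p} → Prime p → ∀ {n} l → 0 < n → 0 < n * p ^ l
*^-positive {p} p-prime l n>0 = *-positive n>0 (m^n>0 p {{>-nonZero (prime>0 p-prime)}} l)

coprime-to-prime : ∀ {p x} → Prime p → ¬ p ∣ x → Coprime x p
coprime-to-prime p-prime p∤x (i∣x , i∣p) with prime⇒irreducible p-prime i∣p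
... | inj₁ i≡1 = i≡1
... | inj₂ refl = ⊥-elim (p∤x i∣x)

*-pull : ∀ n p l → n * p ^ suc l ≡ p * (n * p ^ l)
*-pull n p l = solve 3 (λ n p q → n :* (p :* q) := p :* (n :* q)) refl n p (p ^ l)

coprime-∣-*^ : ∀ {p x} n l → Coprime x p → x ∣ n * p ^ l → x ∣ n
coprime-∣-*^ {p} {x} n zero _ x∣n*1 = subst (x ∣_) (*-identityʳ n) x∣n*1
coprime-∣-*^ {p} {x} n (suc l) x⊥p x∣n*p^l+1 =
  coprime-∣-*^ n l x⊥p (coprime-divisor x⊥p (subst (x ∣_) (*-pull n p l) x∣n*p^l+1))

_∤?_ : ∀ p d → Dec (¬ p ∣ d)
p ∤? d = ¬? (p ∣? d)

coprime-divisors : ∀ {p} → Prime p → ∀ n l → 0 < n → gcd n p ≡ 1 →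
  filter (p ∤?_) (divisors (n * p ^ l)) ≡ divisors n
coprime-divisors {p} p-prime n l n>0 gcd≡1 =
  sorted-members-≡ (AllPairsₚ.filter⁺ (p ∤?_) (divisors-sorted (n * p ^ l))) (divisors-sorted n)
    to from
  where
  to : ∀ {d} → d ∈ filter (p ∤?_) (divisors (n * p ^ l)) → d ∈ divisors n
  to d∈ with ∈-filter⁻ (p ∤?_) d∈
  ... | d∈N , p∤d with ∈-divisors⁻ (n * p ^ l) d∈N
  ...   | d>0 , d∣N = ∈-divisors⁺ n n>0 d>0 (coprime-∣-*^ n l (coprime-to-prime p-prime p∤d) d∣N)
  from : ∀ {d} → d ∈ divisors n → d ∈ filter (p ∤?_) (divisors (n * p ^ l))
  from {d} d∈ with ∈-divisors⁻ n d∈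
  ... | d>0 , d∣n = ∈-filter⁺ (p ∤?_)
         (∈-divisors⁺ (n * p ^ l) (*^-positive p-prime l n>0) d>0 (∣-trans d∣n (m∣m*n (p ^ l)))) p∤d
    where
    -- p ∣ d would make p a common divisor of n and p, i.e. p ∣ 1
    p∤d : ¬ p ∣ d
    p∤d p∣d = <-irrefl (sym (∣1⇒≡1 (subst (p ∣_) gcd≡1 (gcd-greatest (∣-trans p∣d d∣n) ∣-refl))))
                (prime>1 p-prime)

multiple-divisors : ∀ {p} → 0 < p → ∀ K → 0 < K →
  filter (p ∣?_) (divisors (p * K)) ≡ map (p *_) (divisors K)
multiple-divisors {p} p>0 K K>0 =
  sorted-members-≡ (AllPairsₚ.filter⁺ (p ∣?_) (divisors-sorted (p * K)))
    (AllPairsₚ.map⁺ (AllPairs.map (*-monoʳ-< p) (divisors-sorted K))) to from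
  where
  instance _ = >-nonZero p>0
  to : ∀ {d} → d ∈ filter (p ∣?_) (divisors (p * K)) → d ∈ map (p *_) (divisors K)
  to d∈ with ∈-filter⁻ (p ∣?_) {xs = divisors (p * K)} d∈
  ... | d∈pK , divides q refl with ∈-divisors⁻ (p * K) d∈pK
  ...   | qp>0 , qp∣pK = subst (_∈ map (p *_) (divisors K)) (*-comm p q)
            (∈-map⁺ (p *_) (∈-divisors⁺ K K>0 (*-positive⁻ q qp>0) q∣K))
    where
    q∣K : q ∣ K
    q∣K = *-cancelˡ-∣ p (subst (_∣ p * K) (*-comm q p) qp∣pK)
  from : ∀ {d} → d ∈ map (p *_) (divisors K) → d ∈ filter (p ∣?_) (divisors (p * K))
  from d∈ with ∈-map⁻ (p *_) d∈
  ... | e , e∈K , refl with ∈-divisors⁻ K e∈K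
  ...   | e>0 , e∣K = ∈-filter⁺ (p ∣?_)
            (∈-divisors⁺ (p * K) (*-positive p>0 K>0) (*-positive p>0 e>0) (*-monoʳ-∣ p e∣K))
            (m∣m*n e)

sum-filter : ∀ {ℓ} {P : Pred ℕ ℓ} (P? : Decidable P) xs →
  sum xs ≡ sum (filter P? xs) + sum (filter (λ x → ¬? (P? x)) xs)
sum-filter P? [] = refl
sum-filter P? (x ∷ xs) with P? x
... | yes _ = trans (cong (x +_) (sum-filter P? xs)) (sym (+-assoc x _ _))
... | no _  = trans (cong (x +_) (sum-filter P? xs)) (x+[a+b]≡a+[x+b] x (sum (filter P? xs)) _)
  where
  x+[a+b]≡a+[x+b] : ∀ x a b → x + (a + b) ≡ a + (x + b)
  x+[a+b]≡a+[x+b] = solve 3 (λ x a b → x :+ (a :+ b) := a :+ (x :+ b)) refl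

sum-map-* : ∀ p ys → sum (map (p *_) ys) ≡ p * sum ys
sum-map-* p [] = sym (*-zeroʳ p)
sum-map-* p (y ∷ ys) = trans (cong (p * y +_) (sum-map-* p ys)) (sym (*-distribˡ-+ p y (sum ys)))

-- The recursion σ(n·p^(l+1)) = σ(n) + p·σ(n·pˡ) for p ∤ n: split the divisors
-- of n·p^(l+1) into the multiples of p and the divisors of n.
σ-step : ∀ {p} → Prime p → ∀ n l → 0 < n → gcd n p ≡ 1 →
  σ (n * p ^ suc l) ≡ σ n + p * σ (n * p ^ l)
σ-step {p} p-prime n l n>0 gcd≡1 = begin
  σ (n * p ^ suc l)
    ≡⟨ sum-filter (p ∣?_) (divisors (n * p ^ suc l)) ⟩
  sum (filter (p ∣?_) (divisors (n * p ^ suc l))) + sum (filter (p ∤?_) (divisors (n * p ^ suc l)))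
    ≡⟨ cong₂ _+_ multiples (cong sum (coprime-divisors p-prime n (suc l) n>0 gcd≡1)) ⟩
  p * σ (n * p ^ l) + σ n
    ≡⟨ +-comm (p * σ (n * p ^ l)) (σ n) ⟩
  σ n + p * σ (n * p ^ l) ∎
  where
  open ≡-Reasoning
  multiples : sum (filter (p ∣?_) (divisors (n * p ^ suc l))) ≡ p * σ (n * p ^ l)
  multiples = begin
    sum (filter (p ∣?_) (divisors (n * p ^ suc l)))
      ≡⟨ cong (λ m → sum (filter (p ∣?_) (divisors m))) (*-pull n p l) ⟩
    sum (filter (p ∣?_) (divisors (p * (n * p ^ l))))
      ≡⟨ cong sum (multiple-divisors (prime>0 p-prime) (n * p ^ l) (*^-positive p-prime l n>0)) ⟩
    sum (map (p *_) (divisors (n * p ^ l)))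
      ≡⟨ sum-map-* p (divisors (n * p ^ l)) ⟩
    p * σ (n * p ^ l) ∎

picked : Bool → Bool → ℕ → ℕ
picked true  true  x = x
picked false false x = x
picked _     _     _ = 0

sumWith-cons : ∀ b c x xs bs → sumWith b (x ∷ xs) (c ∷ bs) ≡ picked b c x + sumWith b xs bs
sumWith-cons true  true  x xs bs = refl
sumWith-cons true  false x xs bs = refl
sumWith-cons false true  x xs bs = refl
sumWith-cons false false x xs bs = refl

picked-* : ∀ b c p x → picked b c (p * x) ≡ p * picked b c x
picked-* true  true  p x = refl
picked-* true  false p x = sym (*-zeroʳ p)
picked-* false true  p x = sym (*-zeroʳ p)
picked-* false false p x = refl

picked≤ : ∀ b c x → picked b c x ≤ x
picked≤ true  true  x = ≤-refl
picked≤ true  false x = z≤n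
picked≤ false true  x = z≤n
picked≤ false false x = ≤-refl

picked-total : ∀ c x → picked true c x + picked false c x ≡ x
picked-total true  x = +-identityʳ x
picked-total false x = refl

sumWith≤sum : ∀ b xs bs → sumWith b xs bs ≤ sum xs
sumWith≤sum b [] bs = z≤n
sumWith≤sum b (x ∷ xs) [] = z≤n
sumWith≤sum b (x ∷ xs) (c ∷ bs) rewrite sumWith-cons b c x xs bs =
  +-mono-≤ (picked≤ b c x) (sumWith≤sum b xs bs)

sumWith-total : ∀ xs bs → length bs ≡ length xs →
  sumWith true xs bs + sumWith false xs bs ≡ sum xs
sumWith-total [] bs _ = refl
sumWith-total (x ∷ xs) (c ∷ bs) length≡ = begin
  sumWith true (x ∷ xs) (c ∷ bs) + sumWith false (x ∷ xs) (c ∷ bs)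
    ≡⟨ cong₂ _+_ (sumWith-cons true c x xs bs) (sumWith-cons false c x xs bs) ⟩
  (picked true c x + sumWith true xs bs) + (picked false c x + sumWith false xs bs)
    ≡⟨ interchange (picked true c x) _ (picked false c x) _ ⟩
  (picked true c x + picked false c x) + (sumWith true xs bs + sumWith false xs bs)
    ≡⟨ cong₂ _+_ (picked-total c x) (sumWith-total xs bs (suc-injective length≡)) ⟩
  x + sum xs ∎
  where
  open ≡-Reasoning
  interchange : ∀ a s b t → (a + s) + (b + t) ≡ (a + b) + (s + t)
  interchange = solve 4 (λ a s b t → (a :+ s) :+ (b :+ t) := (a :+ b) :+ (s :+ t)) refl

zumkeller-σ-even : ∀ m → IsZumkeller m → ∃ λ h → σ m ≡ h + h
zumkeller-σ-even m (bs , length≡ , halves≡) =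
  sumWith false (divisors m) bs ,
  trans (sym (sumWith-total (divisors m) bs length≡))
        (cong (_+ sumWith false (divisors m) bs) halves≡)

restrict : ℕ → List ℕ → List Bool → List Bool
restrict p [] _ = []
restrict p (x ∷ xs) [] = []
restrict p (x ∷ xs) (c ∷ bs) with p ∣? x
... | yes _ = restrict p xs bs
... | no _  = c ∷ restrict p xs bs

restrict-length : ∀ p xs bs → length bs ≡ length xs →
  length (restrict p xs bs) ≡ length (filter (p ∤?_) xs)
restrict-length p [] bs _ = refl
restrict-length p (x ∷ xs) (c ∷ bs) length≡ with p ∣? x
... | yes _ = restrict-length p xs bs (suc-injective length≡)
... | no _  = cong suc (restrict-length p xs bs (suc-injective length≡))

restrict-sum : ∀ p b xs bs → ∃ λ y →
  sumWith b xs bs ≡ sumWith b (filter (p ∤?_) xs) (restrict p xs bs) + p * y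
restrict-sum p b [] bs = 0 , sym (*-zeroʳ p)
restrict-sum p b (x ∷ xs) [] = 0 , sym (cong₂ _+_ (sumWith-nil (filter (p ∤?_) (x ∷ xs))) (*-zeroʳ p))
  where
  sumWith-nil : ∀ ys → sumWith b ys [] ≡ 0
  sumWith-nil [] = refl
  sumWith-nil (_ ∷ _) = refl
restrict-sum p b (x ∷ xs) (c ∷ bs) with restrict-sum p b xs bs | p ∣? x
... | y , rest≡ | yes (divides q refl) = picked b c q + y , (begin
  sumWith b (q * p ∷ xs) (c ∷ bs)
    ≡⟨ sumWith-cons b c (q * p) xs bs ⟩
  picked b c (q * p) + sumWith b xs bs
    ≡⟨ cong₂ _+_ (trans (cong (picked b c) (*-comm q p)) (picked-* b c p q)) rest≡ ⟩
  p * picked b c q + (s + p * y)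
    ≡⟨ regroup p (picked b c q) s y ⟩
  s + p * (picked b c q + y) ∎)
  where
  open ≡-Reasoning
  s = sumWith b (filter (p ∤?_) xs) (restrict p xs bs)
  regroup : ∀ p a s y → p * a + (s + p * y) ≡ s + p * (a + y)
  regroup = solve 4 (λ p a s y → p :* a :+ (s :+ p :* y) := s :+ p :* (a :+ y)) refl
... | y , rest≡ | no _ = y , (begin
  sumWith b (x ∷ xs) (c ∷ bs)
    ≡⟨ sumWith-cons b c x xs bs ⟩
  picked b c x + sumWith b xs bs
    ≡⟨ cong (picked b c x +_) rest≡ ⟩
  picked b c x + (s + p * y)
    ≡⟨ sym (+-assoc (picked b c x) s (p * y)) ⟩
  (picked b c x + s) + p * y
    ≡⟨ cong (_+ p * y) (sym (sumWith-cons b c x _ _)) ⟩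
  sumWith b (x ∷ filter (p ∤?_) xs) (c ∷ restrict p xs bs) + p * y ∎)
  where
  open ≡-Reasoning
  s = sumWith b (filter (p ∤?_) xs) (restrict p xs bs)

congruent-below-≡ : ∀ p a c y z → a + p * y ≡ c + p * z → a < p → c < p → a ≡ c
congruent-below-≡ p@(suc _) a c y z a+py≡c+pz a<p c<p = begin
  a                ≡⟨ sym (m<n⇒m%n≡m a<p) ⟩
  a % p            ≡⟨ sym ([m+kn]%n≡m%n a y p) ⟩
  (a + y * p) % p  ≡⟨ cong (λ m → (a + m) % p) (*-comm y p) ⟩
  (a + p * y) % p  ≡⟨ cong (_% p) a+py≡c+pz ⟩
  (c + p * z) % p  ≡⟨ cong (λ m → (c + m) % p) (*-comm p z) ⟩
  (c + z * p) % p  ≡⟨ [m+kn]%n≡m%n c z p ⟩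
  c % p            ≡⟨ m<n⇒m%n≡m c<p ⟩
  c                ∎
  where open ≡-Reasoning

zumkeller-restricts : ∀ {p} → Prime p → ∀ n l → 0 < n → gcd n p ≡ 1 → σ n < p →
  IsZumkeller (n * p ^ l) → IsZumkeller n
zumkeller-restricts {p} p-prime n l n>0 gcd≡1 σn<p (bs , length≡ , halves≡) =
  cs , cs-length , congruent-below-≡ p _ _ (proj₁ trueSide) (proj₁ falseSide)
         restricted-congruent (side<p true) (side<p false)
  where
  xs = divisors (n * p ^ l)
  filter≡ : filter (p ∤?_) xs ≡ divisors n
  filter≡ = coprime-divisors p-prime n l n>0 gcd≡1
  cs = restrict p xs bs
  cs-length : length cs ≡ length (divisors n)
  cs-length = trans (restrict-length p xs bs length≡) (cong length filter≡)
  side<p : ∀ b → sumWith b (divisors n) cs < p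
  side<p b = ≤-<-trans (sumWith≤sum b (divisors n) cs) σn<p
  trueSide = restrict-sum p true xs bs
  falseSide = restrict-sum p false xs bs
  restricted-congruent : sumWith true (divisors n) cs + p * proj₁ trueSide
                       ≡ sumWith false (divisors n) cs + p * proj₁ falseSide
  restricted-congruent =
    subst (λ ds → sumWith true ds cs + p * proj₁ trueSide ≡ sumWith false ds cs + p * proj₁ falseSide)
      filter≡ (trans (sym (proj₂ trueSide)) (trans halves≡ (proj₂ falseSide)))

parity : ∀ m → (∃ λ k → m ≡ k + k) ⊎ IsOdd m
parity zero = inj₁ (0 , refl)
parity (suc m) with parity m
... | inj₁ (k , refl) = inj₂ (k , refl)
... | inj₂ (k , refl) = inj₁ (suc k , cong suc (sym (+-suc k k)))

even≢odd′ : ∀ h k → h + h ≢ suc (k + k)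
even≢odd′ h k h+h≡1+k+k = even≢odd h k (begin
  2 * h            ≡⟨ cong (h +_) (+-identityʳ h) ⟩
  h + h            ≡⟨ h+h≡1+k+k ⟩
  suc (k + k)      ≡⟨ cong (λ m → suc (k + m)) (sym (+-identityʳ k)) ⟩
  suc (2 * k)      ∎)
  where open ≡-Reasoning

-- a + p·(a + p·x) is odd when a and x are: for even p the second summand is
-- even, for odd p the sum is a·(1+p) (even) plus p²·x (odd).
odd-step : ∀ p a x → IsOdd a → IsOdd x → IsOdd (a + p * (a + p * x))
odd-step p _ _ (a , refl) (c , refl) with parity p
... | inj₁ (q , refl) = a + q * (suc (a + a) + (q + q) * suc (c + c)) ,
  solve 3 (λ a q c →
    A a :+ (q :+ q) :* (A a :+ (q :+ q) :* A c)
      := con 1 :+ ((a :+ q :* (A a :+ (q :+ q) :* A c)) :+ (a :+ q :* (A a :+ (q :+ q) :* A c))))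
    refl a q c
  where A = λ v → con 1 :+ (v :+ v)
... | inj₂ (q , refl) = a + suc (q + q) * (suc a + c + q * suc (c + c)) ,
  solve 3 (λ a q c →
    A a :+ A q :* (A a :+ A q :* A c)
      := con 1 :+ ((a :+ A q :* ((con 1 :+ a) :+ c :+ q :* A c))
                   :+ (a :+ A q :* ((con 1 :+ a) :+ c :+ q :* A c))))
    refl a q c
  where A = λ v → con 1 :+ (v :+ v)

σ-odd-at-even-powers : ∀ {p} → Prime p → ∀ n → 0 < n → gcd n p ≡ 1 → IsOdd (σ n) →
  ∀ k → IsOdd (σ (n * p ^ (k + k)))
σ-odd-at-even-powers {p} p-prime n n>0 gcd≡1 σn-odd zero =
  subst (λ m → IsOdd (σ m)) (sym (*-identityʳ n)) σn-odd
σ-odd-at-even-powers {p} p-prime n n>0 gcd≡1 σn-odd (suc k) = subst IsOdd (sym two-steps)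
  (odd-step p (σ n) (σ (n * p ^ (k + k))) σn-odd
    (σ-odd-at-even-powers p-prime n n>0 gcd≡1 σn-odd k))
  where
  open ≡-Reasoning
  two-steps : σ (n * p ^ (suc k + suc k)) ≡ σ n + p * (σ n + p * σ (n * p ^ (k + k)))
  two-steps = begin
    σ (n * p ^ (suc k + suc k))          ≡⟨ cong (λ e → σ (n * p ^ suc e)) (+-suc k k) ⟩
    σ (n * p ^ suc (suc (k + k)))        ≡⟨ σ-step p-prime n (suc (k + k)) n>0 gcd≡1 ⟩
    σ n + p * σ (n * p ^ suc (k + k))    ≡⟨ cong (λ s → σ n + p * s) (σ-step p-prime n (k + k) n>0 gcd≡1) ⟩
    σ n + p * (σ n + p * σ (n * p ^ (k + k))) ∎

mainTheorem6 : (l n p : ℕ) → 0 < l → 0 < n → ¬ IsZumkeller n → Prime p → gcd n p ≡ 1 →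
    ((IsZumkeller (n * p ^ l) → p ≤ σ n) ×
     (IsZumkeller (n * p ^ l) → IsOdd (σ n) → IsOdd l))
mainTheorem6 l n p _ n>0 n-not-zumkeller p-prime gcd≡1 = prime-bound , odd-exponent
  where
  -- σ(n) < p would make n Zumkeller.
  prime-bound : IsZumkeller (n * p ^ l) → p ≤ σ n
  prime-bound N-zumkeller with p ≤? σ n
  ... | yes p≤σn = p≤σn
  ... | no p≰σn = ⊥-elim (n-not-zumkeller
          (zumkeller-restricts p-prime n l n>0 gcd≡1 (≰⇒> p≰σn) N-zumkeller))
  -- For l = 2k, σ(n·pˡ) would be both odd and (being Zumkeller) even.
  odd-exponent : IsZumkeller (n * p ^ l) → IsOdd (σ n) → IsOdd l
  odd-exponent N-zumkeller σn-odd with parity l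
  ... | inj₂ l-odd = l-odd
  ... | inj₁ (k , refl) with zumkeller-σ-even (n * p ^ (k + k)) N-zumkeller
                           | σ-odd-at-even-powers p-prime n n>0 gcd≡1 σn-odd k
  ...   | h , σ≡h+h | w , σ≡1+w+w = ⊥-elim (even≢odd′ h w (trans (sym σ≡h+h) σ≡1+w+w))
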